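{- For every integer $n\ge 0$, \[ \sum_{k=0}^{n}\binom{n}{k}^2\binom{2n+k}{n}\binom{3n+k}{n}=\binom{2n}{n}\binom{3n}{n}^2. \]
   Context: $\binom{m}{j}$ is the usual binomial coefficient for integers $m\ge0$, with $\binom{m}{j}=0$ if $j<0$ or $j>m$. -}

module Defs where

open import Data.Nat using (ℕ; suc; _+_; _*_)
open import Data.Nat.Combinatorics using (_C_)
open import Data.List using (upTo; map)
open import Data.Nat.ListAction using (sum)

sumTo : ℕ → (ℕ → ℕ) → ℕ
sumTo n f = sum (map f (upTo (suc n)))

-- By trinomial revision C(2n+k,n) C(3n+k,n) = C(2n,n) C(3n+k,2n), so the theorem is the case
-- x = 3n, m = n of  Σ_k C(n,k) C(m,k) C(x+k,n+m) = C(x,n) C(x,m).  That identity goes by induction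
-- on x: Pascal's rule applied to all three binomials splits the sum for (x+1, n+1, m+1) into the
-- sums for (x, n+1, m+1), (x, n, m+1), (x, n+1, m) and (x, n, m), the one cross term left over being
-- absorbed by summation by parts; this matches Pascal's rule applied to C(x+1,n+1) C(x+1,m+1).

module Submission where

open import Defs
open import Data.Nat using (ℕ; zero; suc; _+_; _*_; _∸_; _!; _<_; _≤?_; z≤n; s≤s)
open import Data.Nat.Combinatorics using (_C_; nCk≡n!/k![n-k]!; k![n∸k]!∣n!; k>n⇒nCk≡0; nCk+nC[k+1]≡[n+1]C[k+1])
open import Data.Nat.DivMod using (_/_; m/n*n≡m)
open import Data.Nat.ListAction using (sum)
open import Data.Nat.ListAction.Properties using (sum-++)
open import Data.Nat.Properties
open import Data.Nat.Tactic.RingSolver using (solve-∀)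
open import Data.List using (applyUpTo; _++_; _∷_; [])
open import Data.List.Properties using (applyUpTo-∷ʳ; map-applyUpTo)
open import Function using (_∘_)
open import Relation.Nullary using (yes; no)
open import Relation.Binary.PropositionalEquality
open ≡-Reasoning

Σ< : ℕ → (ℕ → ℕ) → ℕ
Σ< B f = sum (applyUpTo f B)

sumTo≡Σ< : ∀ n f → sumTo n f ≡ Σ< (suc n) f
sumTo≡Σ< n f = cong sum (map-applyUpTo (λ k → k) f (suc n))

Σ<-cong : ∀ B {f g : ℕ → ℕ} → (∀ k → f k ≡ g k) → Σ< B f ≡ Σ< B g
Σ<-cong zero    f≡g = refl
Σ<-cong (suc B) f≡g = cong₂ _+_ (f≡g 0) (Σ<-cong B (f≡g ∘ suc))

Σ<-+ : ∀ B {f g : ℕ → ℕ} → Σ< B (λ k → f k + g k) ≡ Σ< B f + Σ< B g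
Σ<-+ zero = refl
Σ<-+ (suc B) {f} {g} = begin
  f 0 + g 0 + Σ< B (λ k → f (suc k) + g (suc k)) ≡⟨ cong (f 0 + g 0 +_) (Σ<-+ B) ⟩
  f 0 + g 0 + (Σ< B (f ∘ suc) + Σ< B (g ∘ suc))  ≡⟨ +-+-swap (f 0) (g 0) _ _ ⟩
  f 0 + Σ< B (f ∘ suc) + (g 0 + Σ< B (g ∘ suc))  ∎
  where
  +-+-swap : ∀ a b c d → a + b + (c + d) ≡ a + c + (b + d)
  +-+-swap = solve-∀

Σ<-*ˡ : ∀ B c (f : ℕ → ℕ) → Σ< B (λ k → c * f k) ≡ c * Σ< B f
Σ<-*ˡ zero    c f = sym (*-zeroʳ c)
Σ<-*ˡ (suc B) c f = trans (cong (c * f 0 +_) (Σ<-*ˡ B c (f ∘ suc))) (sym (*-distribˡ-+ c (f 0) _))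

Σ<-zero : ∀ B {f : ℕ → ℕ} → (∀ k → f k ≡ 0) → Σ< B f ≡ 0
Σ<-zero zero    f≡0 = refl
Σ<-zero (suc B) f≡0 = cong₂ _+_ (f≡0 0) (Σ<-zero B (f≡0 ∘ suc))

Σ<-head : ∀ B (f : ℕ → ℕ) → (∀ k → f (suc k) ≡ 0) → Σ< (suc B) f ≡ f 0
Σ<-head B f f≡0 = trans (cong (f 0 +_) (Σ<-zero B f≡0)) (+-identityʳ (f 0))

Σ<-last : ∀ B (f : ℕ → ℕ) → Σ< (suc B) f ≡ Σ< B f + f B
Σ<-last B f = begin
  Σ< (suc B) f                       ≡⟨ cong sum (applyUpTo-∷ʳ f B) ⟨
  sum (applyUpTo f B ++ (f B ∷ []))  ≡⟨ sum-++ (applyUpTo f B) (f B ∷ []) ⟩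
  Σ< B f + (f B + 0)                 ≡⟨ cong (Σ< B f +_) (+-identityʳ (f B)) ⟩
  Σ< B f + f B                       ∎

shift : (ℕ → ℕ) → ℕ → ℕ
shift f zero    = 0
shift f (suc k) = f k

shift-* : ∀ (f g : ℕ → ℕ) k → shift (λ i → f i * g i) k ≡ shift f k * shift g k
shift-* f g zero    = refl
shift-* f g (suc k) = refl

Σ<-by-parts : ∀ B (p c d : ℕ → ℕ) → (∀ k → c (suc k) ≡ c k + d k) → p B ≡ 0 →
  Σ< (suc B) (λ k → shift p k * c k)
  ≡ Σ< (suc B) (λ k → p k * c k) + Σ< (suc B) (λ k → p k * d k)
Σ<-by-parts B p c d Δc pB≡0 = begin
  Σ< B (λ k → p k * c (suc k))                    ≡⟨ Σ<-cong B (λ k → trans (cong (p k *_) (Δc k)) (*-distribˡ-+ (p k) (c k) (d k))) ⟩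
  Σ< B (λ k → p k * c k + p k * d k)              ≡⟨ Σ<-+ B ⟩
  Σ< B (λ k → p k * c k) + Σ< B (λ k → p k * d k) ≡⟨ cong₂ _+_ (extendByZero c) (extendByZero d) ⟩
  Σ< (suc B) (λ k → p k * c k) + Σ< (suc B) (λ k → p k * d k) ∎
  where
  extendByZero : ∀ f → Σ< B (λ k → p k * f k) ≡ Σ< (suc B) (λ k → p k * f k)
  extendByZero f = sym (begin
    Σ< (suc B) (λ k → p k * f k)         ≡⟨ Σ<-last B _ ⟩
    Σ< B (λ k → p k * f k) + p B * f B   ≡⟨ cong (λ z → Σ< B (λ k → p k * f k) + z * f B) pB≡0 ⟩
    Σ< B (λ k → p k * f k) + 0           ≡⟨ +-identityʳ _ ⟩
    Σ< B (λ k → p k * f k)               ∎)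

-- A discrete product rule: the left side is what Pascal's rule makes of a product of three
-- binomials, and the cross term Σ shift a * shift b * c is traded, by parts, for Σ a * b * d.
Σ<-product-rule : ∀ B (a b c d e : ℕ → ℕ) → (∀ k → c (suc k) ≡ c k + d k) → a B ≡ 0 →
  Σ< (suc B) (λ k → (a k + shift a k) * (b k + shift b k) * (e k + c k))
  ≡ Σ< (suc B) (λ k → (a k + shift a k) * (b k + shift b k) * e k)
  + Σ< (suc B) (λ k → a k * (b k + shift b k) * c k)
  + Σ< (suc B) (λ k → (a k + shift a k) * b k * c k)
  + Σ< (suc B) (λ k → a k * b k * d k)
Σ<-product-rule B a b c d e Δc aB≡0 = +-cancelʳ-≡ (S X) _ _ (begin
  S L + S X                             ≡⟨ Σ<-+ (suc B) {L} {X} ⟨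
  S (λ k → L k + X k)                   ≡⟨ Σ<-cong (suc B) (λ k → expand (a k) (shift a k) (b k) (shift b k) (c k) (e k)) ⟩
  S (λ k → E k + P k + Q k + Y k)       ≡⟨ split ⟩
  S E + S P + S Q + S Y                 ≡⟨ cong (S E + S P + S Q +_) shifted-by-parts ⟩
  S E + S P + S Q + (S X + S D)         ≡⟨ cong (S E + S P + S Q +_) (+-comm (S X) (S D)) ⟩
  S E + S P + S Q + (S D + S X)         ≡⟨ +-assoc (S E + S P + S Q) (S D) (S X) ⟨
  S E + S P + S Q + S D + S X           ∎)
  where
  S : (ℕ → ℕ) → ℕ
  S = Σ< (suc B)
  L E P Q X Y D : ℕ → ℕ
  L k = (a k + shift a k) * (b k + shift b k) * (e k + c k)
  E k = (a k + shift a k) * (b k + shift b k) * e k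
  P k = a k * (b k + shift b k) * c k
  Q k = (a k + shift a k) * b k * c k
  X k = a k * b k * c k
  Y k = shift a k * shift b k * c k
  D k = a k * b k * d k
  expand : ∀ a a′ b b′ c e →
    (a + a′) * (b + b′) * (e + c) + a * b * c
    ≡ (a + a′) * (b + b′) * e + a * (b + b′) * c + (a + a′) * b * c + a′ * b′ * c
  expand = solve-∀
  split : S (λ k → E k + P k + Q k + Y k) ≡ S E + S P + S Q + S Y
  split = begin
    S (λ k → E k + P k + Q k + Y k)     ≡⟨ Σ<-+ (suc B) {λ k → E k + P k + Q k} {Y} ⟩
    S (λ k → E k + P k + Q k) + S Y     ≡⟨ cong (_+ S Y) (Σ<-+ (suc B) {λ k → E k + P k} {Q}) ⟩
    S (λ k → E k + P k) + S Q + S Y     ≡⟨ cong (λ z → z + S Q + S Y) (Σ<-+ (suc B) {E} {P}) ⟩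
    S E + S P + S Q + S Y               ∎
  shifted-by-parts : S Y ≡ S X + S D
  shifted-by-parts = begin
    S Y                                       ≡⟨ Σ<-cong (suc B) (λ k → cong (_* c k) (shift-* a b k)) ⟨
    S (λ k → shift (λ i → a i * b i) k * c k) ≡⟨ Σ<-by-parts B (λ i → a i * b i) c d Δc (cong (_* b B) aB≡0) ⟩
    S X + S D                                 ∎

suc-C : ∀ n k → suc n C k ≡ n C k + shift (n C_) k
suc-C n zero    = refl
suc-C n (suc k) = trans (sym (nCk+nC[k+1]≡[n+1]C[k+1] n k)) (+-comm (n C k) (n C suc k))

suc-C-suc : ∀ n k → suc n C suc k ≡ n C suc k + n C k
suc-C-suc n k = suc-C n (suc k)

nCk*kC[n+1+m]≡0 : ∀ n m k → (n C k) * (k C (n + suc m)) ≡ 0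
nCk*kC[n+1+m]≡0 n m k with k ≤? n
... | yes k≤n = trans (cong ((n C k) *_) (k>n⇒nCk≡0 (≤-<-trans k≤n (m<m+n n (s≤s z≤n))))) (*-zeroʳ (n C k))
... | no  k≰n = cong (_* (k C (n + suc m))) (k>n⇒nCk≡0 (≰⇒> k≰n))

[a+b]Ca*a!*b!≡[a+b]! : ∀ a b → ((a + b) C a) * (a ! * b !) ≡ (a + b) !
[a+b]Ca*a!*b!≡[a+b]! a b = begin
  ((a + b) C a) * (a ! * b !)                 ≡⟨ cong (λ z → ((a + b) C a) * (a ! * z !)) (m+n∸m≡n a b) ⟨
  ((a + b) C a) * (a ! * (a + b ∸ a) !)       ≡⟨ cong (_* (a ! * (a + b ∸ a) !)) (nCk≡n!/k![n-k]! a≤a+b) ⟩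
  (a + b) ! / (a ! * (a + b ∸ a) !) * (a ! * (a + b ∸ a) !) ≡⟨ m/n*n≡m (k![n∸k]!∣n! a≤a+b) ⟩
  (a + b) !                                   ∎
  where
  a≤a+b = m≤m+n a b
  instance _ = a !* (a + b ∸ a) !≢0

trinomial-revision : ∀ a b c →
  ((b + c) C b) * ((a + (b + c)) C a) ≡ ((a + b) C a) * ((a + b + c) C (a + b))
trinomial-revision a b c = *-cancelʳ-≡ _ _ (a ! * (b ! * c !)) {{m*n≢0 _ _ {{a !≢0}} {{b !* c !≢0}}}} (begin
  ((b + c) C b) * ((a + (b + c)) C a) * (a ! * (b ! * c !))   ≡⟨ regroupˡ ((b + c) C b) ((a + (b + c)) C a) (a !) (b ! * c !) ⟩
  ((a + (b + c)) C a) * (a ! * (((b + c) C b) * (b ! * c !))) ≡⟨ cong (λ z → ((a + (b + c)) C a) * (a ! * z)) ([a+b]Ca*a!*b!≡[a+b]! b c) ⟩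
  ((a + (b + c)) C a) * (a ! * (b + c) !)                     ≡⟨ [a+b]Ca*a!*b!≡[a+b]! a (b + c) ⟩
  (a + (b + c)) !                                             ≡⟨ cong _! (+-assoc a b c) ⟨
  (a + b + c) !                                               ≡⟨ [a+b]Ca*a!*b!≡[a+b]! (a + b) c ⟨
  ((a + b + c) C (a + b)) * ((a + b) ! * c !)                 ≡⟨ cong (λ z → ((a + b + c) C (a + b)) * (z * c !)) ([a+b]Ca*a!*b!≡[a+b]! a b) ⟨
  ((a + b + c) C (a + b)) * (((a + b) C a) * (a ! * b !) * c !) ≡⟨ regroupʳ ((a + b) C a) ((a + b + c) C (a + b)) (a !) (b !) (c !) ⟩
  ((a + b) C a) * ((a + b + c) C (a + b)) * (a ! * (b ! * c !)) ∎)
  where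
  regroupˡ : ∀ x y p q → x * y * (p * q) ≡ y * (p * (x * q))
  regroupˡ = solve-∀
  regroupʳ : ∀ x y p q r → y * (x * (p * q) * r) ≡ x * y * (p * (q * r))
  regroupʳ = solve-∀

tripleTerm : ℕ → ℕ → ℕ → ℕ → ℕ
tripleTerm x n m k = (n C k) * (m C k) * ((x + k) C (n + m))

tripleSum : ℕ → ℕ → ℕ → ℕ → ℕ
tripleSum B x n m = Σ< B (tripleTerm x n m)

tripleSum-suc : ∀ B x n m → n < B →
  tripleSum (suc B) (suc x) (suc n) (suc m)
  ≡ tripleSum (suc B) x (suc n) (suc m) + tripleSum (suc B) x n (suc m)
  + tripleSum (suc B) x (suc n) m + tripleSum (suc B) x n m
tripleSum-suc B x n m n<B =
  trans (Σ<-cong (suc B) pascal³)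
  (trans (Σ<-product-rule B (n C_) (m C_) c d e Δc (k>n⇒nCk≡0 n<B))
  (sym (cong₂ _+_ (cong₂ _+_ (cong₂ _+_
    (Σ<-cong (suc B) λ k → cong (_* e k) (cong₂ _*_ (suc-C n k) (suc-C m k)))
    (Σ<-cong (suc B) λ k → cong₂ _*_ (cong ((n C k) *_) (suc-C m k)) (cong ((x + k) C_) (+-suc n m))))
    (Σ<-cong (suc B) λ k → cong (λ z → z * (m C k) * c k) (suc-C n k)))
    refl)))
  where
  c d e : ℕ → ℕ
  c k = (x + k) C suc (n + m)
  d k = (x + k) C (n + m)
  e k = (x + k) C (suc n + suc m)
  Δc : ∀ k → c (suc k) ≡ c k + d k
  Δc k = trans (cong (_C suc (n + m)) (+-suc x k)) (suc-C-suc (x + k) (n + m))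
  pascal³ : ∀ k → (suc n C k) * (suc m C k) * ((suc x + k) C (suc n + suc m))
                  ≡ ((n C k) + shift (n C_) k) * ((m C k) + shift (m C_) k) * (e k + c k)
  pascal³ k = cong₂ _*_ (cong₂ _*_ (suc-C n k) (suc-C m k))
                        (trans (suc-C-suc (x + k) (n + suc m)) (cong (λ z → e k + (x + k) C z) (+-suc n m)))

-- Any bound B > n covers the support k ≤ n of the summand.
tripleSum≡xCn*xCm : ∀ B x n m → n < B → tripleSum B x n m ≡ (x C n) * (x C m)
tripleSum≡xCn*xCm (suc B) x zero m _ = begin
  tripleSum (suc B) x zero m  ≡⟨ Σ<-head B (tripleTerm x zero m) (λ _ → refl) ⟩
  1 * ((x + 0) C m)           ≡⟨ cong (λ z → 1 * (z C m)) (+-identityʳ x) ⟩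
  1 * (x C m)                 ∎
tripleSum≡xCn*xCm (suc B) x (suc n) zero _ = begin
  tripleSum (suc B) x (suc n) zero  ≡⟨ Σ<-head B (tripleTerm x (suc n) zero) (λ k → cong (_* ((x + suc k) C (suc n + 0))) (*-zeroʳ (suc n C suc k))) ⟩
  1 * ((x + 0) C (suc n + 0))       ≡⟨ *-identityˡ _ ⟩
  (x + 0) C (suc n + 0)             ≡⟨ cong₂ _C_ (+-identityʳ x) (+-identityʳ (suc n)) ⟩
  x C suc n                         ≡⟨ *-identityʳ _ ⟨
  (x C suc n) * 1                   ∎
tripleSum≡xCn*xCm B zero (suc n) (suc m) _ = Σ<-zero B vanish
  where
  vanish : ∀ k → (suc n C k) * (suc m C k) * (k C (suc n + suc m)) ≡ 0
  vanish k = begin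
    (suc n C k) * (suc m C k) * (k C (suc n + suc m))   ≡⟨ cong (_* (k C (suc n + suc m))) (*-comm (suc n C k) (suc m C k)) ⟩
    (suc m C k) * (suc n C k) * (k C (suc n + suc m))   ≡⟨ *-assoc (suc m C k) _ _ ⟩
    (suc m C k) * ((suc n C k) * (k C (suc n + suc m))) ≡⟨ cong ((suc m C k) *_) (nCk*kC[n+1+m]≡0 (suc n) m k) ⟩
    (suc m C k) * 0                                     ≡⟨ *-zeroʳ (suc m C k) ⟩
    0                                                   ∎
tripleSum≡xCn*xCm (suc B) (suc x) (suc n) (suc m) (s≤s n<B) = begin
  tripleSum (suc B) (suc x) (suc n) (suc m)
    ≡⟨ tripleSum-suc B x n m n<B ⟩
  tripleSum (suc B) x (suc n) (suc m) + tripleSum (suc B) x n (suc m)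
    + tripleSum (suc B) x (suc n) m + tripleSum (suc B) x n m
    ≡⟨ cong₂ _+_ (cong₂ _+_ (cong₂ _+_ (ih (suc n) (suc m) (s≤s n<B)) (ih n (suc m) (m<n⇒m<1+n n<B)))
                                       (ih (suc n) m (s≤s n<B)))
                 (ih n m (m<n⇒m<1+n n<B)) ⟩
  (x C suc n) * (x C suc m) + (x C n) * (x C suc m) + (x C suc n) * (x C m) + (x C n) * (x C m)
    ≡⟨ foil (x C suc n) (x C n) (x C suc m) (x C m) ⟨
  (x C suc n + x C n) * (x C suc m + x C m)
    ≡⟨ cong₂ _*_ (suc-C-suc x n) (suc-C-suc x m) ⟨
  (suc x C suc n) * (suc x C suc m) ∎
  where
  ih : ∀ n m → n < suc B → tripleSum (suc B) x n m ≡ (x C n) * (x C m)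
  ih = tripleSum≡xCn*xCm (suc B) x
  foil : ∀ p q r s → (p + q) * (r + s) ≡ p * r + q * r + p * s + q * s
  foil = solve-∀

summand≡[2n]Cn*tripleTerm : ∀ n k →
  (n C k) * (n C k) * ((2 * n + k) C n) * ((3 * n + k) C n) ≡ ((2 * n) C n) * tripleTerm (3 * n) n n k
summand≡[2n]Cn*tripleTerm n k = begin
  (n C k) * (n C k) * ((2 * n + k) C n) * ((3 * n + k) C n)
    ≡⟨ *-assoc ((n C k) * (n C k)) _ _ ⟩
  (n C k) * (n C k) * (((2 * n + k) C n) * ((3 * n + k) C n))
    ≡⟨ cong ((n C k) * (n C k) *_) revision ⟩
  (n C k) * (n C k) * (((2 * n) C n) * ((3 * n + k) C (n + n)))
    ≡⟨ x*[y*z]≡y*[x*z] ((n C k) * (n C k)) ((2 * n) C n) _ ⟩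
  ((2 * n) C n) * tripleTerm (3 * n) n n k ∎
  where
  x*[y*z]≡y*[x*z] : ∀ x y z → x * (y * z) ≡ y * (x * z)
  x*[y*z]≡y*[x*z] = solve-∀
  2n+k≡n+[n+k] : ∀ n k → 2 * n + k ≡ n + (n + k)
  2n+k≡n+[n+k] = solve-∀
  2n≡n+n : ∀ n → 2 * n ≡ n + n
  2n≡n+n = solve-∀
  3n+k≡n+[n+[n+k]] : ∀ n k → 3 * n + k ≡ n + (n + (n + k))
  3n+k≡n+[n+[n+k]] = solve-∀
  3n+k≡n+n+[n+k] : ∀ n k → 3 * n + k ≡ n + n + (n + k)
  3n+k≡n+n+[n+k] = solve-∀
  revision : ((2 * n + k) C n) * ((3 * n + k) C n) ≡ ((2 * n) C n) * ((3 * n + k) C (n + n))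
  revision = begin
    ((2 * n + k) C n) * ((3 * n + k) C n)
      ≡⟨ cong₂ (λ p q → (p C n) * (q C n)) (2n+k≡n+[n+k] n k) (3n+k≡n+[n+[n+k]] n k) ⟩
    ((n + (n + k)) C n) * ((n + (n + (n + k))) C n)
      ≡⟨ trinomial-revision n n (n + k) ⟩
    ((n + n) C n) * ((n + n + (n + k)) C (n + n))
      ≡⟨ cong₂ (λ p q → (p C n) * (q C (n + n))) (2n≡n+n n) (3n+k≡n+n+[n+k] n k) ⟨
    ((2 * n) C n) * ((3 * n + k) C (n + n)) ∎

mainTheorem5 : (n : ℕ) →
    sumTo n (λ k → (n C k) * (n C k) * ((2 * n + k) C n) * ((3 * n + k) C n))
      ≡ ((2 * n) C n) * ((3 * n) C n) * ((3 * n) C n)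
mainTheorem5 n = begin
  sumTo n (λ k → (n C k) * (n C k) * ((2 * n + k) C n) * ((3 * n + k) C n))
    ≡⟨ sumTo≡Σ< n _ ⟩
  Σ< (suc n) (λ k → (n C k) * (n C k) * ((2 * n + k) C n) * ((3 * n + k) C n))
    ≡⟨ Σ<-cong (suc n) (summand≡[2n]Cn*tripleTerm n) ⟩
  Σ< (suc n) (λ k → ((2 * n) C n) * tripleTerm (3 * n) n n k)
    ≡⟨ Σ<-*ˡ (suc n) ((2 * n) C n) (tripleTerm (3 * n) n n) ⟩
  ((2 * n) C n) * tripleSum (suc n) (3 * n) n n
    ≡⟨ cong (((2 * n) C n) *_) (tripleSum≡xCn*xCm (suc n) (3 * n) n n (n<1+n n)) ⟩
  ((2 * n) C n) * (((3 * n) C n) * ((3 * n) C n))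
    ≡⟨ *-assoc ((2 * n) C n) _ _ ⟨
  ((2 * n) C n) * ((3 * n) C n) * ((3 * n) C n) ∎
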